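{- Let $k,N\in\mathbb{N}$ with $N\ge k$, and let $f:\{0,1\}^k\to\{0,1\}^N$ be such that there exists $r\in\mathbb{N}$ with $1\le r\le N$ and $\|f(\alpha)-f(\alpha')\|_1=r\|\alpha-\alpha'\|_1$ for all $\alpha,\alpha'\in\{0,1\}^k$. Then there exist $b\in\{0,1\}^N$ and pairwise disjoint subsets $I_1,\dots,I_k\subseteq[N]$, each of size $r$, such that $$f(\alpha)=b+\sum_{i\in[k]:\alpha_i=1}\mathbf 1_{I_i}\quad\text{for all }\alpha\in\{0,1\}^k,$$ where addition is coordinatewise mod 2 and $\mathbf 1_{I}\in\{0,1\}^N$ is the indicator vector of $I$.
   Context: $\|x-y\|_1=|\{i:x_i\ne y_i\}|$ is the Hamming distance; $[N]=\{1,\dots,N\}$. -}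

module Defs where

open import Data.Nat using (ℕ; zero; suc)
open import Data.Bool using (Bool; true; false; _xor_; if_then_else_)
open import Data.Fin using (Fin; zero; suc)
open import Data.Vec using (Vec; lookup; tabulate; zipWith; replicate; count)
open import Data.Fin.Subset using (Subset; _∈_; _∩_; ⊥; ∣_∣)
open import Data.Fin.Subset.Properties using (_∈?_)
open import Relation.Binary.PropositionalEquality using (_≡_; _≢_)
open import Relation.Nullary using (does; ¬?)

-- Points of the Hamming cube {0,1}^n (false = 0, true = 1).
Cube : ℕ → Set
Cube n = Vec Bool n

hamming : ∀ {n} → Cube n → Cube n → ℕ
hamming {n} x y = count (λ i → ¬? (lookup x i Data.Bool.≟ lookup y i)) (Data.Vec.allFin n)

_⊕_ : ∀ {n} → Cube n → Cube n → Cube n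
_⊕_ = zipWith _xor_

infixl 6 _⊕_

indicator : ∀ {N} → Subset N → Cube N
indicator I = tabulate (λ j → does (j ∈? I))

sumSelected : ∀ {k N} → Cube k → (Fin k → Cube N) → Cube N
sumSelected {zero}  α v = replicate _ false
sumSelected {suc k} α v =
  (if lookup α zero then v zero else replicate _ false)
  ⊕ sumSelected (Data.Vec.tail α) (λ i → v (suc i))

PairwiseDisjoint : ∀ {k N} → (Fin k → Subset N) → Set
PairwiseDisjoint I = ∀ i j → i ≢ j → I i ∩ I j ≡ ⊥

{-# OPTIONS --safe #-}
-- Translating by b = f 0 gives g α = b ⊕ f α with g 0 = 0 and ∣ g α ⊕ g β ∣ = r ∣ α ⊕ β ∣.
-- The polarisation identity ∣ p ⊕ q ∣ + 2 ∣ p ∩ q ∣ = ∣ p ∣ + ∣ q ∣ shows that g scales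
-- intersection sizes by r as well, so the images I_i = g e_i of the unit vectors are pairwise
-- disjoint sets of size r.  On the first coordinate, g e₁ ⊕ g (1α) has the size r ∣ α ∣ of
-- g (0α) and meets it in r ∣ α ∣ points, hence equals it: g (1α) = g e₁ ⊕ g (0α).  Since g
-- restricted to the face α₁ = 0 is again such a map, induction on k expands g α as the sum of
-- the I_i with α_i = 1.
module Submission where

open import Defs
open import Data.Nat using (ℕ; zero; suc; _+_; _*_; _≤_)
open import Data.Nat.Properties
  using (+-suc; +-identityʳ; +-cancelˡ-≡; +-cancelʳ-≡; *-cancelˡ-≡; *-distribˡ-+; *-zeroʳ; *-identityʳ)
open import Data.Nat.Tactic.RingSolver using (solve-∀)
open import Data.Bool using (Bool; true; false; _xor_; _≟_)
open import Data.Bool.Properties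
  using (xor-assoc; xor-comm; xor-identityˡ; xor-identityʳ; xor-same; ∧-distribˡ-xor)
open import Data.Fin using (Fin; zero; suc)
open import Data.Fin.Subset using (Subset; ⊥; ⁅_⁆; _∩_; ∣_∣)
open import Data.Fin.Subset.Properties using (∩-zeroˡ; ∩-zeroʳ; ∩-idem; ∣⊥∣≡0; ∣⁅x⁆∣≡1)
open import Data.Vec using ([]; _∷_; lookup; tabulate; count)
open import Data.Vec.Properties
  using (zipWith-assoc; zipWith-comm; zipWith-identityˡ; zipWith-identityʳ; zipWith-distribˡ;
         lookup-zipWith; tabulate-cong; tabulate∘lookup)
open import Data.Product using (Σ; _×_; _,_)
open import Function using (id; _∘_)
open import Relation.Binary.PropositionalEquality
  using (_≡_; _≢_; _≗_; refl; sym; trans; cong; cong₂; module ≡-Reasoning)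
open import Relation.Nullary using (does; ¬?)
open import Relation.Nullary.Negation using (contradiction)
open import Relation.Unary using (Pred; Decidable)

open ≡-Reasoning

private
  variable
    k n N : ℕ

⊕-assoc : (x y z : Cube n) → (x ⊕ y) ⊕ z ≡ x ⊕ (y ⊕ z)
⊕-assoc = zipWith-assoc xor-assoc

⊕-comm : (x y : Cube n) → x ⊕ y ≡ y ⊕ x
⊕-comm = zipWith-comm xor-comm

⊕-identityˡ : (x : Cube n) → ⊥ ⊕ x ≡ x
⊕-identityˡ = zipWith-identityˡ xor-identityˡ

⊕-identityʳ : (x : Cube n) → x ⊕ ⊥ ≡ x
⊕-identityʳ = zipWith-identityʳ xor-identityʳ

⊕-same : (x : Cube n) → x ⊕ x ≡ ⊥
⊕-same []      = refl
⊕-same (a ∷ x) = cong₂ _∷_ (xor-same a) (⊕-same x)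

x⊕[x⊕y]≡y : (x y : Cube n) → x ⊕ (x ⊕ y) ≡ y
x⊕[x⊕y]≡y x y = begin
  x ⊕ (x ⊕ y)  ≡⟨ ⊕-assoc x x y ⟨
  (x ⊕ x) ⊕ y  ≡⟨ cong (_⊕ y) (⊕-same x) ⟩
  ⊥ ⊕ y        ≡⟨ ⊕-identityˡ y ⟩
  y            ∎

[x⊕y]⊕[x⊕z]≡y⊕z : (x y z : Cube n) → (x ⊕ y) ⊕ (x ⊕ z) ≡ y ⊕ z
[x⊕y]⊕[x⊕z]≡y⊕z x y z = begin
  (x ⊕ y) ⊕ (x ⊕ z)  ≡⟨ cong (_⊕ (x ⊕ z)) (⊕-comm x y) ⟩
  (y ⊕ x) ⊕ (x ⊕ z)  ≡⟨ ⊕-assoc y x (x ⊕ z) ⟩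
  y ⊕ (x ⊕ (x ⊕ z))  ≡⟨ cong (y ⊕_) (x⊕[x⊕y]≡y x z) ⟩
  y ⊕ z              ∎

x⊕y≡⊥⇒x≡y : (x y : Cube n) → x ⊕ y ≡ ⊥ → x ≡ y
x⊕y≡⊥⇒x≡y x y x⊕y≡⊥ = begin
  x            ≡⟨ ⊕-identityʳ x ⟨
  x ⊕ ⊥        ≡⟨ cong (x ⊕_) x⊕y≡⊥ ⟨
  x ⊕ (x ⊕ y)  ≡⟨ x⊕[x⊕y]≡y x y ⟩
  y            ∎

∩-distribˡ-⊕ : (x y z : Subset n) → x ∩ (y ⊕ z) ≡ (x ∩ y) ⊕ (x ∩ z)
∩-distribˡ-⊕ = zipWith-distribˡ ∧-distribˡ-xor

indicator≗id : indicator {n} ≗ id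
indicator≗id []          = refl
indicator≗id (true ∷ p)  = cong (true ∷_) (indicator≗id p)
indicator≗id (false ∷ p) = cong (false ∷_) (indicator≗id p)

x≢y⇒⁅x⁆∩⁅y⁆≡⊥ : {x y : Fin n} → x ≢ y → ⁅ x ⁆ ∩ ⁅ y ⁆ ≡ ⊥
x≢y⇒⁅x⁆∩⁅y⁆≡⊥ {x = zero}  {zero}  x≢y = contradiction refl x≢y
x≢y⇒⁅x⁆∩⁅y⁆≡⊥ {x = zero}  {suc y} _   = cong (false ∷_) (∩-zeroˡ ⁅ y ⁆)
x≢y⇒⁅x⁆∩⁅y⁆≡⊥ {x = suc x} {zero}  _   = cong (false ∷_) (∩-zeroʳ ⁅ x ⁆)
x≢y⇒⁅x⁆∩⁅y⁆≡⊥ {x = suc x} {suc y} x≢y = cong (false ∷_) (x≢y⇒⁅x⁆∩⁅y⁆≡⊥ (x≢y ∘ cong suc))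

∣p∣≡0⇒p≡⊥ : (p : Subset n) → ∣ p ∣ ≡ 0 → p ≡ ⊥
∣p∣≡0⇒p≡⊥ []          _    = refl
∣p∣≡0⇒p≡⊥ (true ∷ p)  ()
∣p∣≡0⇒p≡⊥ (false ∷ p) ∣p∣≡0 = cong (false ∷_) (∣p∣≡0⇒p≡⊥ p ∣p∣≡0)

count-tabulate : ∀ {a} {A : Set} {P : Pred A a} (P? : Decidable P) (f : Fin n → A) →
                 count P? (tabulate f) ≡ ∣ tabulate (λ i → does (P? (f i))) ∣
count-tabulate {n = zero}  P? f = refl
count-tabulate {n = suc n} P? f with does (P? (f zero))
... | true  = cong suc (count-tabulate P? (f ∘ suc))
... | false = count-tabulate P? (f ∘ suc)

hamming≡∣⊕∣ : (x y : Cube n) → hamming x y ≡ ∣ x ⊕ y ∣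
hamming≡∣⊕∣ x y = begin
  hamming x y
    ≡⟨ count-tabulate (λ i → ¬? (lookup x i ≟ lookup y i)) id ⟩
  ∣ tabulate (λ i → does (¬? (lookup x i ≟ lookup y i))) ∣
    ≡⟨ cong ∣_∣ (tabulate-cong λ i →
         trans (differ≡xor (lookup x i) (lookup y i)) (sym (lookup-zipWith _xor_ i x y))) ⟩
  ∣ tabulate (lookup (x ⊕ y)) ∣
    ≡⟨ cong ∣_∣ (tabulate∘lookup (x ⊕ y)) ⟩
  ∣ x ⊕ y ∣ ∎
  where
  differ≡xor : (a b : Bool) → does (¬? (a ≟ b)) ≡ a xor b
  differ≡xor false false = refl
  differ≡xor false true  = refl
  differ≡xor true  false = refl
  differ≡xor true  true  = refl

∣p⊕q∣+2∣p∩q∣≡∣p∣+∣q∣ : (p q : Subset n) → ∣ p ⊕ q ∣ + 2 * ∣ p ∩ q ∣ ≡ ∣ p ∣ + ∣ q ∣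
∣p⊕q∣+2∣p∩q∣≡∣p∣+∣q∣ []          []          = refl
∣p⊕q∣+2∣p∩q∣≡∣p∣+∣q∣ (false ∷ p) (false ∷ q) = ∣p⊕q∣+2∣p∩q∣≡∣p∣+∣q∣ p q
∣p⊕q∣+2∣p∩q∣≡∣p∣+∣q∣ (true ∷ p)  (false ∷ q) = cong suc (∣p⊕q∣+2∣p∩q∣≡∣p∣+∣q∣ p q)
∣p⊕q∣+2∣p∩q∣≡∣p∣+∣q∣ (false ∷ p) (true ∷ q)  =
  trans (cong suc (∣p⊕q∣+2∣p∩q∣≡∣p∣+∣q∣ p q)) (sym (+-suc ∣ p ∣ ∣ q ∣))
∣p⊕q∣+2∣p∩q∣≡∣p∣+∣q∣ (true ∷ p)  (true ∷ q)  = begin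
  ∣ p ⊕ q ∣ + 2 * suc ∣ p ∩ q ∣    ≡⟨ shift ∣ p ⊕ q ∣ ∣ p ∩ q ∣ ⟩
  2 + (∣ p ⊕ q ∣ + 2 * ∣ p ∩ q ∣)  ≡⟨ cong (2 +_) (∣p⊕q∣+2∣p∩q∣≡∣p∣+∣q∣ p q) ⟩
  2 + (∣ p ∣ + ∣ q ∣)              ≡⟨ cong suc (+-suc ∣ p ∣ ∣ q ∣) ⟨
  suc ∣ p ∣ + suc ∣ q ∣            ∎
  where
  shift : ∀ a c → a + 2 * suc c ≡ 2 + (a + 2 * c)
  shift = solve-∀

∣p∣≡∣q∣≡∣p∩q∣⇒p≡q : ∀ {m} (p q : Subset n) → ∣ p ∣ ≡ m → ∣ q ∣ ≡ m → ∣ p ∩ q ∣ ≡ m → p ≡ q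
∣p∣≡∣q∣≡∣p∩q∣⇒p≡q {m = m} p q ∣p∣≡m ∣q∣≡m ∣p∩q∣≡m =
  x⊕y≡⊥⇒x≡y p q (∣p∣≡0⇒p≡⊥ (p ⊕ q) (+-cancelʳ-≡ (2 * m) ∣ p ⊕ q ∣ 0 ∣p⊕q∣+2m≡2m))
  where
  ∣p⊕q∣+2m≡2m : ∣ p ⊕ q ∣ + 2 * m ≡ 2 * m
  ∣p⊕q∣+2m≡2m = begin
    ∣ p ⊕ q ∣ + 2 * m          ≡⟨ cong (λ c → ∣ p ⊕ q ∣ + 2 * c) ∣p∩q∣≡m ⟨
    ∣ p ⊕ q ∣ + 2 * ∣ p ∩ q ∣  ≡⟨ ∣p⊕q∣+2∣p∩q∣≡∣p∣+∣q∣ p q ⟩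
    ∣ p ∣ + ∣ q ∣              ≡⟨ cong₂ _+_ ∣p∣≡m ∣q∣≡m ⟩
    m + m                      ≡⟨ cong (m +_) (+-identityʳ m) ⟨
    2 * m                      ∎

record IsScaledIsometry (r : ℕ) (g : Cube k → Cube N) : Set where
  constructor scales
  field
    distance : ∀ α β → ∣ g α ⊕ g β ∣ ≡ r * ∣ α ⊕ β ∣

open IsScaledIsometry

translate-isometry : ∀ {r} (b : Cube N) (f : Cube k → Cube N) →
                     (∀ α β → hamming (f α) (f β) ≡ r * hamming α β) →
                     IsScaledIsometry r (λ α → b ⊕ f α)
translate-isometry {r = r} b f f-iso = scales λ α β → begin
  ∣ (b ⊕ f α) ⊕ (b ⊕ f β) ∣  ≡⟨ cong ∣_∣ ([x⊕y]⊕[x⊕z]≡y⊕z b (f α) (f β)) ⟩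
  ∣ f α ⊕ f β ∣              ≡⟨ hamming≡∣⊕∣ (f α) (f β) ⟨
  hamming (f α) (f β)        ≡⟨ f-iso α β ⟩
  r * hamming α β            ≡⟨ cong (r *_) (hamming≡∣⊕∣ α β) ⟩
  r * ∣ α ⊕ β ∣              ∎

restrict-to-face : ∀ {r} {g : Cube (suc k) → Cube N} →
                   IsScaledIsometry r g → IsScaledIsometry r (g ∘ (false ∷_))
restrict-to-face g-iso = scales λ α β → distance g-iso (false ∷ α) (false ∷ β)

module ScaledIsometry {r} {g : Cube k → Cube N}
                      (g⊥≡⊥ : g ⊥ ≡ ⊥) (g-iso : IsScaledIsometry r g) where

  ∣gα∣≡r*∣α∣ : ∀ α → ∣ g α ∣ ≡ r * ∣ α ∣
  ∣gα∣≡r*∣α∣ α = begin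
    ∣ g α ∣          ≡⟨ cong ∣_∣ (⊕-identityʳ (g α)) ⟨
    ∣ g α ⊕ ⊥ ∣      ≡⟨ cong (λ s → ∣ g α ⊕ s ∣) g⊥≡⊥ ⟨
    ∣ g α ⊕ g ⊥ ∣    ≡⟨ distance g-iso α ⊥ ⟩
    r * ∣ α ⊕ ⊥ ∣    ≡⟨ cong (λ β → r * ∣ β ∣) (⊕-identityʳ α) ⟩
    r * ∣ α ∣        ∎

  ∣gα∩gβ∣≡r*∣α∩β∣ : ∀ α β → ∣ g α ∩ g β ∣ ≡ r * ∣ α ∩ β ∣
  ∣gα∩gβ∣≡r*∣α∩β∣ α β =
    *-cancelˡ-≡ _ _ 2 (+-cancelˡ-≡ ∣ g α ⊕ g β ∣ _ _ (begin
      ∣ g α ⊕ g β ∣ + 2 * ∣ g α ∩ g β ∣  ≡⟨ ∣p⊕q∣+2∣p∩q∣≡∣p∣+∣q∣ (g α) (g β) ⟩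
      ∣ g α ∣ + ∣ g β ∣                  ≡⟨ cong₂ _+_ (∣gα∣≡r*∣α∣ α) (∣gα∣≡r*∣α∣ β) ⟩
      r * ∣ α ∣ + r * ∣ β ∣              ≡⟨ *-distribˡ-+ r ∣ α ∣ ∣ β ∣ ⟨
      r * (∣ α ∣ + ∣ β ∣)                ≡⟨ cong (r *_) (∣p⊕q∣+2∣p∩q∣≡∣p∣+∣q∣ α β) ⟨
      r * (∣ α ⊕ β ∣ + 2 * ∣ α ∩ β ∣)    ≡⟨ regroup r ∣ α ⊕ β ∣ ∣ α ∩ β ∣ ⟩
      r * ∣ α ⊕ β ∣ + 2 * (r * ∣ α ∩ β ∣) ≡⟨ cong (_+ 2 * (r * ∣ α ∩ β ∣)) (distance g-iso α β) ⟨
      ∣ g α ⊕ g β ∣ + 2 * (r * ∣ α ∩ β ∣) ∎))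
    where
    regroup : ∀ r a c → r * (a + 2 * c) ≡ r * a + 2 * (r * c)
    regroup = solve-∀

  α∩β≡⊥⇒gα∩gβ≡⊥ : ∀ α β → α ∩ β ≡ ⊥ → g α ∩ g β ≡ ⊥
  α∩β≡⊥⇒gα∩gβ≡⊥ α β α∩β≡⊥ = ∣p∣≡0⇒p≡⊥ (g α ∩ g β) (begin
    ∣ g α ∩ g β ∣  ≡⟨ ∣gα∩gβ∣≡r*∣α∩β∣ α β ⟩
    r * ∣ α ∩ β ∣  ≡⟨ cong (r *_) (trans (cong ∣_∣ α∩β≡⊥) (∣⊥∣≡0 k)) ⟩
    r * 0          ≡⟨ *-zeroʳ r ⟩
    0              ∎)

split-head : ∀ {r} {g : Cube (suc k) → Cube N} → g ⊥ ≡ ⊥ → IsScaledIsometry r g →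
             ∀ α → g (true ∷ α) ≡ g ⁅ zero ⁆ ⊕ g (false ∷ α)
split-head {r = r} {g} g⊥≡⊥ g-iso α = begin
  x            ≡⟨ x⊕[x⊕y]≡y e x ⟨
  e ⊕ (e ⊕ x)  ≡⟨ cong (e ⊕_) q≡e⊕x ⟨
  e ⊕ q        ∎
  where
  open ScaledIsometry g⊥≡⊥ g-iso
  x e q : Cube _
  x = g (true ∷ α)
  e = g ⁅ zero ⁆
  q = g (false ∷ α)

  ∣e⊕x∣ : ∣ e ⊕ x ∣ ≡ r * ∣ α ∣
  ∣e⊕x∣ = trans (distance g-iso ⁅ zero ⁆ (true ∷ α)) (cong (λ β → r * ∣ β ∣) (⊕-identityˡ α))

  ∣q∩[e⊕x]∣ : ∣ q ∩ (e ⊕ x) ∣ ≡ r * ∣ α ∣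
  ∣q∩[e⊕x]∣ = begin
    ∣ q ∩ (e ⊕ x) ∣        ≡⟨ cong ∣_∣ (∩-distribˡ-⊕ q e x) ⟩
    ∣ (q ∩ e) ⊕ (q ∩ x) ∣  ≡⟨ cong (λ s → ∣ s ⊕ (q ∩ x) ∣) q∩e≡⊥ ⟩
    ∣ ⊥ ⊕ (q ∩ x) ∣        ≡⟨ cong ∣_∣ (⊕-identityˡ (q ∩ x)) ⟩
    ∣ q ∩ x ∣              ≡⟨ ∣gα∩gβ∣≡r*∣α∩β∣ (false ∷ α) (true ∷ α) ⟩
    r * ∣ α ∩ α ∣          ≡⟨ cong (λ β → r * ∣ β ∣) (∩-idem α) ⟩
    r * ∣ α ∣              ∎
    where
    q∩e≡⊥ : q ∩ e ≡ ⊥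
    q∩e≡⊥ = α∩β≡⊥⇒gα∩gβ≡⊥ (false ∷ α) ⁅ zero ⁆ (cong (false ∷_) (∩-zeroʳ α))

  q≡e⊕x : q ≡ e ⊕ x
  q≡e⊕x = ∣p∣≡∣q∣≡∣p∩q∣⇒p≡q q (e ⊕ x) (∣gα∣≡r*∣α∣ (false ∷ α)) ∣e⊕x∣ ∣q∩[e⊕x]∣

unit-expansion : ∀ {r} {g : Cube k → Cube N} → g ⊥ ≡ ⊥ → IsScaledIsometry r g →
                 ∀ α → g α ≡ sumSelected α (λ i → indicator (g ⁅ i ⁆))
unit-expansion g⊥≡⊥ _ [] = g⊥≡⊥
unit-expansion g⊥≡⊥ g-iso (false ∷ α) =
  trans (unit-expansion g⊥≡⊥ (restrict-to-face g-iso) α) (sym (⊕-identityˡ _))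
unit-expansion {g = g} g⊥≡⊥ g-iso (true ∷ α) =
  trans (split-head g⊥≡⊥ g-iso α)
        (cong₂ _⊕_ (sym (indicator≗id (g ⁅ zero ⁆)))
                   (unit-expansion g⊥≡⊥ (restrict-to-face g-iso) α))

mainTheorem10 : (k N : ℕ) → k ≤ N → (f : Cube k → Cube N) → (r : ℕ) →
    1 ≤ r → r ≤ N →
    (∀ α α′ → hamming (f α) (f α′) ≡ r * hamming α α′) →
    Σ (Cube N) λ b → Σ (Fin k → Subset N) λ I →
      PairwiseDisjoint I × (∀ i → ∣ I i ∣ ≡ r) ×
      (∀ α → f α ≡ b ⊕ sumSelected α (λ i → indicator (I i)))
mainTheorem10 k N _ f r _ _ f-iso = b , I , I-disjoint , ∣I∣≡r , f≡b⊕sum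
  where
  b : Cube N
  b = f ⊥

  g : Cube k → Cube N
  g α = b ⊕ f α

  g-iso : IsScaledIsometry r g
  g-iso = translate-isometry b f f-iso

  g⊥≡⊥ : g ⊥ ≡ ⊥
  g⊥≡⊥ = ⊕-same b

  open ScaledIsometry g⊥≡⊥ g-iso

  I : Fin k → Subset N
  I i = g ⁅ i ⁆

  I-disjoint : PairwiseDisjoint I
  I-disjoint i j i≢j = α∩β≡⊥⇒gα∩gβ≡⊥ ⁅ i ⁆ ⁅ j ⁆ (x≢y⇒⁅x⁆∩⁅y⁆≡⊥ i≢j)

  ∣I∣≡r : ∀ i → ∣ I i ∣ ≡ r
  ∣I∣≡r i = trans (∣gα∣≡r*∣α∣ ⁅ i ⁆) (trans (cong (r *_) (∣⁅x⁆∣≡1 i)) (*-identityʳ r))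

  f≡b⊕sum : ∀ α → f α ≡ b ⊕ sumSelected α (λ i → indicator (I i))
  f≡b⊕sum α = trans (sym (x⊕[x⊕y]≡y b (f α))) (cong (b ⊕_) (unit-expansion g⊥≡⊥ g-iso α))
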